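{- Let $G$ be a graph and $M$ a matching in $G$. If $H$ is a subgraph of $G_M$ all of whose edges are red, then $|E(H)|\leq |V(H)|$.
   Context: All graphs are finite, simple and undirected. For a matching $M$ in $G$, $G[M]$ is the subgraph of $G$ induced by the endpoints of edges of $M$, and $G_M$ is the simple graph obtained from $G[M]$ by contracting each edge $xy\in M$ to a vertex $v_{xy}$ and removing parallel edges (so $v_{ab}v_{cd}\in E(G_M)$ iff some edge of $G$ joins a vertex of $\{a,b\}$ to a vertex of $\{c,d\}$). Each edge $v_{ab}v_{cd}$ of $G_M$ is coloured red if there exist labellings with $\{\{p,q\},\{r,s\}\}=\{\{a,b\},\{c,d\}\}$ such that $pr\in E(G)$, $d_{G[M]}(p)=2$ and $d_{G[M]}(q)>2$; otherwise it is coloured blue. Here $d_{G[M]}$ denotes degree in $G[M]$. -}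

module Defs where

open import Data.Bool using (Bool; true; false; T; _∧_)
open import Data.Nat using (ℕ; _≤_; _<_)
open import Data.Fin using (Fin) renaming (_<_ to _<ᶠ_)
open import Data.Fin.Properties using (_≟_)
open import Data.Fin.Subset using (Subset; _∈_; ∣_∣)
open import Data.Product using (_×_; _,_; ∃-syntax; Σ-syntax)
open import Data.Sum using (_⊎_)
open import Data.List using (List; []; _∷_; length; filter; concatMap; lookup)
open import Data.List.Relation.Unary.Any using (Any; any?)
open import Data.List.Relation.Unary.All using (All)
open import Data.List.Relation.Unary.Unique.Propositional using (Unique)
open import Relation.Binary.PropositionalEquality using (_≡_)
open import Relation.Nullary using (¬_; Dec)
open import Relation.Nullary.Decidable using (_×-dec_)
open import Data.Sum.Relation.Unary.All using () 
open import Data.List.Base using (allFin)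

record Graph : Set where
  field
    n      : ℕ
    adj    : Fin n → Fin n → Bool
    sym    : ∀ u v → adj u v ≡ adj v u
    irrefl : ∀ u → adj u u ≡ false

module _ (G : Graph) where
  open Graph G

  Adj : Fin n → Fin n → Set
  Adj u v = T (adj u v)

  Edge : Set
  Edge = Fin n × Fin n

  endpoints : List Edge → List (Fin n)
  endpoints = concatMap (λ { (a , b) → a ∷ b ∷ [] })

  -- A matching: a list of edges of G whose endpoints are pairwise distinct
  -- (in particular each listed edge has two distinct ends and no two edges share a vertex).
  IsMatching : List Edge → Set
  IsMatching M = All (λ { (a , b) → Adj a b }) M × Unique (endpoints M)

  InV : List Edge → Fin n → Set
  InV M u = Any (u ≡_) (endpoints M)

  inV? : (M : List Edge) → (u : Fin n) → Dec (InV M u)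
  inV? M u = any? (u ≟_) (endpoints M)

  adj? : (u v : Fin n) → Dec (Adj u v)
  adj? u v with adj u v
  ... | true  = Relation.Nullary.yes _
  ... | false = Relation.Nullary.no (λ ())

  degM : List Edge → Fin n → ℕ
  degM M p = length (filter (λ u → adj? p u ×-dec inV? M u) (allFin n))

  Labels : Edge → Fin n → Fin n → Set
  Labels (a , b) p q = (p ≡ a × q ≡ b) ⊎ (p ≡ b × q ≡ a)

  IsEnd : Edge → Fin n → Set
  IsEnd (a , b) r = r ≡ a ⊎ r ≡ b

  -- Vertices of G_M are indexed by positions in the list M.
  VM : List Edge → Set
  VM M = Fin (length M)

  GMEdge : (M : List Edge) → VM M → VM M → Set
  GMEdge M i j = ¬ (i ≡ j) ×
    ∃[ x ] ∃[ y ] (IsEnd (lookup M i) x × IsEnd (lookup M j) y × Adj x y)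

  RedDir : (M : List Edge) → VM M → VM M → Set
  RedDir M i j = ∃[ p ] ∃[ q ] ∃[ r ]
    (Labels (lookup M i) p q × IsEnd (lookup M j) r × Adj p r
     × degM M p ≡ 2 × 2 < degM M q)

  Red : (M : List Edge) → VM M → VM M → Set
  Red M i j = RedDir M i j ⊎ RedDir M j i

  -- A subgraph H of G_M: vertex set VH ⊆ V(G_M), edge list EH of distinct
  -- unordered pairs (stored as (i , j) with i < j), each an edge of G_M with
  -- both ends in VH.
  IsSubgraphGM : (M : List Edge) → Subset (length M) → List (VM M × VM M) → Set
  IsSubgraphGM M VH EH =
    Unique EH ×
    All (λ { (i , j) → i <ᶠ j × i ∈ VH × j ∈ VH × GMEdge M i j }) EH

  AllRed : (M : List Edge) → List (VM M × VM M) → Set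
  AllRed M EH = All (λ { (i , j) → Red M i j }) EH

-- Orient every red edge v_i v_j of G_M from a tail v_i for which the red condition holds with
-- {p,q} = M_i, {r,s} = M_j. A tail has at most one out-neighbour: two red conditions at v_i must
-- use the same p (the roles of p and q are fixed by the degrees 2 and > 2), and p is then adjacent
-- to its partner q and to the ends r ∈ M_j, r' ∈ M_k; if j ≢ k these are three distinct vertices
-- of V(M), contradicting d_{G[M]}(p) = 2. Distinct edges therefore have distinct tails, so
-- |E(H)| ≤ |V(H)|.
module Submission where

open import Defs
open import Data.Nat using (ℕ; _≤_; s≤s; z≤n) renaming (_<_ to _<ℕ_)
open import Data.Nat.Properties using (m≤n⇒m≤1+n; ≤-trans; <-irrefl)
open import Data.Fin using (Fin; zero; suc; _<_)
open import Data.Fin.Properties using (<-asym; _≟_)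
open import Data.Fin.Subset using (Subset; _∈_; _-_; ∣_∣)
open import Data.Fin.Subset.Properties using (x∈p∧x≢y⇒x∈p-y; x∈p⇒∣p-x∣<∣p∣)
open import Data.Product using (_×_; _,_; proj₁; proj₂)
open import Data.Sum using (_⊎_; inj₁; inj₂)
open import Data.Bool using (T)
open import Data.List using (List; []; _∷_; length; filter; lookup; allFin)
open import Data.List.Relation.Unary.Any using (here; there)
open import Data.List.Relation.Unary.All as All using (All; []; _∷_)
open import Data.List.Relation.Unary.AllPairs using (_∷_)
open import Data.List.Relation.Unary.Unique.Propositional using (Unique)
import Data.List.Membership.Propositional as List
open import Data.List.Membership.Propositional.Properties using (∈-filter⁺; ∈-allFin)
open import Data.Empty using (⊥-elim)
open import Relation.Binary.PropositionalEquality using (_≡_; _≢_; refl; sym; cong; subst; ≢-sym)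
open import Relation.Nullary using (yes; no)
open import Relation.Nullary.Decidable using (_×-dec_)

module _ {A : Set} where

  ∈⇒1≤length : ∀ {a : A} {xs} → a List.∈ xs → 1 ≤ length xs
  ∈⇒1≤length (here _)  = s≤s z≤n
  ∈⇒1≤length (there _) = s≤s z≤n

  distinct₂⇒2≤length : ∀ {a b : A} {xs} → a ≢ b → a List.∈ xs → b List.∈ xs → 2 ≤ length xs
  distinct₂⇒2≤length a≢b (here refl) (here refl) = ⊥-elim (a≢b refl)
  distinct₂⇒2≤length a≢b (here _)    (there b∈)  = s≤s (∈⇒1≤length b∈)
  distinct₂⇒2≤length a≢b (there a∈)  (here _)    = s≤s (∈⇒1≤length a∈)
  distinct₂⇒2≤length a≢b (there a∈)  (there b∈)  = m≤n⇒m≤1+n (distinct₂⇒2≤length a≢b a∈ b∈)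

  distinct₃⇒3≤length : ∀ {a b c : A} {xs} → a ≢ b → a ≢ c → b ≢ c →
    a List.∈ xs → b List.∈ xs → c List.∈ xs → 3 ≤ length xs
  distinct₃⇒3≤length a≢b a≢c b≢c (here refl) (here refl) _           = ⊥-elim (a≢b refl)
  distinct₃⇒3≤length a≢b a≢c b≢c (here refl) (there _)   (here refl) = ⊥-elim (a≢c refl)
  distinct₃⇒3≤length a≢b a≢c b≢c (there _)   (here refl) (here refl) = ⊥-elim (b≢c refl)
  distinct₃⇒3≤length a≢b a≢c b≢c (here _)    (there b∈)  (there c∈)  = s≤s (distinct₂⇒2≤length b≢c b∈ c∈)
  distinct₃⇒3≤length a≢b a≢c b≢c (there a∈)  (here _)    (there c∈)  = s≤s (distinct₂⇒2≤length a≢c a∈ c∈)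
  distinct₃⇒3≤length a≢b a≢c b≢c (there a∈)  (there b∈)  (here _)    = s≤s (distinct₂⇒2≤length a≢b a∈ b∈)
  distinct₃⇒3≤length a≢b a≢c b≢c (there a∈)  (there b∈)  (there c∈)  =
    m≤n⇒m≤1+n (distinct₃⇒3≤length a≢b a≢c b≢c a∈ b∈ c∈)

module OutDegreeOne {m : ℕ} (R : Fin m → Fin m → Set)
  (R-functional : ∀ {i j k} → i ≢ j → i ≢ k → R i j → R i k → j ≡ k) where

  Increasing : Fin m × Fin m → Set
  Increasing (i , j) = i < j

  OrientedFrom : Subset m → Fin m × Fin m → Set
  OrientedFrom S (i , j) = (i ∈ S × R i j) ⊎ (j ∈ S × R j i)

  tail : ∀ {S} e → OrientedFrom S e → Fin m
  tail (i , j) (inj₁ _) = i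
  tail (i , j) (inj₂ _) = j

  tail∈ : ∀ {S} e (o : OrientedFrom S e) → tail e o ∈ S
  tail∈ (i , j) (inj₁ (i∈ , _)) = i∈
  tail∈ (i , j) (inj₂ (j∈ , _)) = j∈

  <⇒≢ : ∀ {i j : Fin m} → i < j → i ≢ j
  <⇒≢ i<j refl = <-irrefl refl i<j

  tail-injective : ∀ {S} e e' → Increasing e → Increasing e' →
    (o : OrientedFrom S e) (o' : OrientedFrom S e') → tail e o ≡ tail e' o' → e ≡ e'
  tail-injective (i , j) (.i , j') i<j i<j' (inj₁ (_ , Rij)) (inj₁ (_ , Rij')) refl =
    cong (i ,_) (R-functional (<⇒≢ i<j) (<⇒≢ i<j') Rij Rij')
  tail-injective (i , j) (i' , .i) i<j i'<i (inj₁ (_ , Rij)) (inj₂ (_ , Rii')) refl =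
    ⊥-elim (<-asym (subst (i <_) j≡i' i<j) i'<i)
    where j≡i' = R-functional (<⇒≢ i<j) (≢-sym (<⇒≢ i'<i)) Rij Rii'
  tail-injective (i , j) (.j , j') i<j j<j' (inj₂ (_ , Rji)) (inj₁ (_ , Rjj')) refl =
    ⊥-elim (<-asym i<j (subst (j <_) (sym i≡j') j<j'))
    where i≡j' = R-functional (≢-sym (<⇒≢ i<j)) (<⇒≢ j<j') Rji Rjj'
  tail-injective (i , j) (i' , .j) i<j i'<j (inj₂ (_ , Rji)) (inj₂ (_ , Rji')) refl =
    cong (_, j) (R-functional (≢-sym (<⇒≢ i<j)) (≢-sym (<⇒≢ i'<j)) Rji Rji')

  OrientedFrom-remove : ∀ {S} t e (o : OrientedFrom S e) → tail e o ≢ t → OrientedFrom (S - t) e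
  OrientedFrom-remove t (i , j) (inj₁ (i∈ , Rij)) i≢t = inj₁ (x∈p∧x≢y⇒x∈p-y i∈ i≢t , Rij)
  OrientedFrom-remove t (i , j) (inj₂ (j∈ , Rji)) j≢t = inj₂ (x∈p∧x≢y⇒x∈p-y j∈ j≢t , Rji)

  length≤∣tails∣ : ∀ S (es : List (Fin m × Fin m)) → Unique es → All Increasing es →
    All (OrientedFrom S) es → length es ≤ ∣ S ∣
  length≤∣tails∣ S [] _ _ _ = z≤n
  length≤∣tails∣ S (e ∷ es) (e∉es ∷ uniq) (inc ∷ incs) (o ∷ os) =
    ≤-trans (s≤s (length≤∣tails∣ (S - tail e o) es uniq incs (remove e∉es incs os)))
            (x∈p⇒∣p-x∣<∣p∣ (tail∈ e o))
    where
    remove : ∀ {es} → All (e ≢_) es → All Increasing es → All (OrientedFrom S) es →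
      All (OrientedFrom (S - tail e o)) es
    remove [] [] [] = []
    remove {e' ∷ _} (e≢e' ∷ ≢s) (inc' ∷ incs') (o' ∷ os') =
      OrientedFrom-remove (tail e o) e' o' (λ t'≡t → e≢e' (tail-injective e e' inc inc' o o' (sym t'≡t)))
      ∷ remove ≢s incs' os'

module _ (G : Graph) where
  open Graph G using (n)

  Adj-sym : ∀ {u v} → Adj G u v → Adj G v u
  Adj-sym {u} {v} = subst T (Graph.sym G u v)

  IsEnd⇒∈endpoints : ∀ M i {x} → IsEnd G (lookup M i) x → x List.∈ endpoints G M
  IsEnd⇒∈endpoints ((a , b) ∷ M) zero    (inj₁ x≡a) = here x≡a
  IsEnd⇒∈endpoints ((a , b) ∷ M) zero    (inj₂ x≡b) = there (here x≡b)
  IsEnd⇒∈endpoints ((a , b) ∷ M) (suc i) x-end      = there (there (IsEnd⇒∈endpoints M i x-end))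

  head-end∉endpoints : ∀ {a b} M {x} → Unique (endpoints G ((a , b) ∷ M)) →
    IsEnd G (a , b) x → x List.∉ endpoints G M
  head-end∉endpoints M ((_ ∷ a∉) ∷ _) (inj₁ refl) x∈ = All.lookup a∉ x∈ refl
  head-end∉endpoints M (_ ∷ (b∉ ∷ _)) (inj₂ refl) x∈ = All.lookup b∉ x∈ refl

  IsEnd-unique : ∀ M → Unique (endpoints G M) → ∀ i j {x} →
    IsEnd G (lookup M i) x → IsEnd G (lookup M j) x → i ≡ j
  IsEnd-unique (e ∷ M) uniq zero zero _ _ = refl
  IsEnd-unique (e ∷ M) uniq zero (suc j) x-end₀ x-endⱼ =
    ⊥-elim (head-end∉endpoints M uniq x-end₀ (IsEnd⇒∈endpoints M j x-endⱼ))
  IsEnd-unique (e ∷ M) uniq (suc i) zero x-endᵢ x-end₀ =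
    ⊥-elim (head-end∉endpoints M uniq x-end₀ (IsEnd⇒∈endpoints M i x-endᵢ))
  IsEnd-unique (e ∷ M) (_ ∷ _ ∷ uniq) (suc i) (suc j) x-endᵢ x-endⱼ =
    cong suc (IsEnd-unique M uniq i j x-endᵢ x-endⱼ)

  Labels⇒Adj : ∀ M → All (λ { (a , b) → Adj G a b }) M → ∀ i {p q} →
    Labels G (lookup M i) p q → Adj G p q
  Labels⇒Adj ((a , b) ∷ M) (ab ∷ _) zero    (inj₁ (refl , refl)) = ab
  Labels⇒Adj ((a , b) ∷ M) (ab ∷ _) zero    (inj₂ (refl , refl)) = Adj-sym ab
  Labels⇒Adj ((a , b) ∷ M) (_ ∷ ab) (suc i) pq-labels            = Labels⇒Adj M ab i pq-labels

  Labels⇒IsEnd₂ : ∀ {e p q} → Labels G e p q → IsEnd G e q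
  Labels⇒IsEnd₂ (inj₁ (_ , q≡b)) = inj₂ q≡b
  Labels⇒IsEnd₂ (inj₂ (_ , q≡a)) = inj₁ q≡a

  Labels-first : ∀ {e p q p' q'} → Labels G e p q → Labels G e p' q' → p ≡ p' ⊎ p ≡ q'
  Labels-first (inj₁ (refl , _)) (inj₁ (refl , _)) = inj₁ refl
  Labels-first (inj₁ (refl , _)) (inj₂ (_ , refl)) = inj₂ refl
  Labels-first (inj₂ (refl , _)) (inj₁ (_ , refl)) = inj₂ refl
  Labels-first (inj₂ (refl , _)) (inj₂ (refl , _)) = inj₁ refl

  NeighbourInV : List (Edge G) → Fin n → Fin n → Set
  NeighbourInV M p u = Adj G p u × InV G M u

  distinct₃-neighbours⇒3≤degM : ∀ M {p a b c} → a ≢ b → a ≢ c → b ≢ c →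
    NeighbourInV M p a → NeighbourInV M p b → NeighbourInV M p c → 3 ≤ degM G M p
  distinct₃-neighbours⇒3≤degM M {p} a≢b a≢c b≢c na nb nc =
    distinct₃⇒3≤length a≢b a≢c b≢c (∈filter na) (∈filter nb) (∈filter nc)
    where
    ∈filter : ∀ {u} → NeighbourInV M p u →
      u List.∈ filter (λ u → adj? G p u ×-dec inV? G M u) (allFin n)
    ∈filter {u} = ∈-filter⁺ (λ u → adj? G p u ×-dec inV? G M u) (∈-allFin u)

  RedDir-functional : ∀ {M} → IsMatching G M → ∀ {i j k} → i ≢ j → i ≢ k →
    RedDir G M i j → RedDir G M i k → j ≡ k
  RedDir-functional {M} (adjM , uniq) {i} {j} {k} i≢j i≢k
    (p , q , r , pq-labels , r-end , pr , deg-p , _) (p' , q' , r' , pq'-labels , r'-end , pr' , _ , deg-q')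
    with Labels-first pq-labels pq'-labels
  ... | inj₂ refl = ⊥-elim (<-irrefl refl (subst (2 <ℕ_) deg-p deg-q'))
  ... | inj₁ refl with r ≟ r'
  ...   | yes refl = IsEnd-unique M uniq j k r-end r'-end
  ...   | no r≢r'  = ⊥-elim (<-irrefl refl (subst (3 ≤_) deg-p
            (distinct₃-neighbours⇒3≤degM M (partner≢ j i≢j r-end) (partner≢ k i≢k r'-end) r≢r'
              (Labels⇒Adj M adjM i pq-labels , IsEnd⇒∈endpoints M i q-end)
              (pr , IsEnd⇒∈endpoints M j r-end) (pr' , IsEnd⇒∈endpoints M k r'-end))))
    where
    q-end : IsEnd G (lookup M i) q
    q-end = Labels⇒IsEnd₂ pq-labels
    partner≢ : ∀ l {x} → i ≢ l → IsEnd G (lookup M l) x → q ≢ x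
    partner≢ l i≢l x-end refl = i≢l (IsEnd-unique M uniq i l q-end x-end)

lemma2 : (G : Graph) (M : List (Edge G)) → IsMatching G M →
    (VH : Subset (length M)) (EH : List (VM G M × VM G M)) →
    IsSubgraphGM G M VH EH → AllRed G M EH →
    length EH ≤ ∣ VH ∣
lemma2 G M matching VH EH (uniq , inH) red =
  length≤∣tails∣ VH EH uniq (All.map proj₁ inH) (All.zipWith (λ {e} → oriented {proj₁ e} {proj₂ e}) (inH , red))
  where
  open OutDegreeOne (RedDir G M) (RedDir-functional G matching)
  oriented : ∀ {i j} → (i < j × i ∈ VH × j ∈ VH × GMEdge G M i j) × Red G M i j →
    OrientedFrom VH (i , j)
  oriented ((_ , i∈ , _ , _) , inj₁ Rij) = inj₁ (i∈ , Rij)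
  oriented ((_ , _ , j∈ , _) , inj₂ Rji) = inj₂ (j∈ , Rji)
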